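{- Let $w = w_1 w_2 \cdots w_n \in S_n$ be a permutation that avoids the patterns $1423$ and $1432$, and let $L(w) = (L_1, \dots, L_n)$ be its Lehmer code. Then $L_{i+1} - L_i \le 1$ for every $1 \le i \le n-1$.
   Context: The Lehmer code of $w$ is $L(w) = (L_1,\dots,L_n)$ with $L_i = |\{ j > i : w_j < w_i\}|$. A permutation $w \in S_n$ contains a pattern $\sigma \in S_k$ if there are indices $i_1 < \cdots < i_k$ such that $w_{i_1}, \dots, w_{i_k}$ are in the same relative order as $\sigma_1, \dots, \sigma_k$; otherwise $w$ avoids $\sigma$. -}

module Defs where

open import Data.Nat using (ℕ; suc)
open import Data.Fin using (Fin; zero; suc; _<_; _<?_; toℕ; inject₁)
open import Data.Fin.Permutation using (Permutation′; _⟨$⟩ʳ_; permutation)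
open import Relation.Binary.PropositionalEquality using (_≡_; refl)
open import Data.List using (List; length; filter; allFin)
open import Data.Product using (Σ; _×_)
open import Relation.Nullary using (¬_)
open import Relation.Nullary.Decidable using (_×-dec_)

-- Permutations of {1..n} are represented as bijections of Fin n (0-indexed);
-- w i is  w ⟨$⟩ʳ i.

L : ∀ {n} → Permutation′ n → Fin n → ℕ
L {n} w i = length (filter (λ j → (i <? j) ×-dec ((w ⟨$⟩ʳ j) <? (w ⟨$⟩ʳ i))) (allFin n))

Contains : ∀ {n k} → Permutation′ n → Permutation′ k → Set
Contains {n} {k} w σ =
  Σ (Fin k → Fin n) λ ι →
    (∀ a b → a < b → ι a < ι b) ×
    (∀ a b → (w ⟨$⟩ʳ ι a < w ⟨$⟩ʳ ι b → σ ⟨$⟩ʳ a < σ ⟨$⟩ʳ b) ×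
             (σ ⟨$⟩ʳ a < σ ⟨$⟩ʳ b → w ⟨$⟩ʳ ι a < w ⟨$⟩ʳ ι b))

Avoids : ∀ {n k} → Permutation′ n → Permutation′ k → Set
Avoids w σ = ¬ Contains w σ

-- Patterns 1423 and 1432 as one-line words, 0-indexed: 0 3 1 2 and 0 3 2 1.
f1423 : Fin 4 → Fin 4
f1423 zero = zero
f1423 (suc zero) = suc (suc (suc zero))
f1423 (suc (suc zero)) = suc zero
f1423 (suc (suc (suc zero))) = suc (suc zero)

g1423 : Fin 4 → Fin 4
g1423 zero = zero
g1423 (suc zero) = suc (suc zero)
g1423 (suc (suc zero)) = suc (suc (suc zero))
g1423 (suc (suc (suc zero))) = suc zero

f1432 : Fin 4 → Fin 4
f1432 zero = zero
f1432 (suc zero) = suc (suc (suc zero))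
f1432 (suc (suc zero)) = suc (suc zero)
f1432 (suc (suc (suc zero))) = suc zero

inv1423ˡ : ∀ x → f1423 (g1423 x) ≡ x
inv1423ˡ zero = refl
inv1423ˡ (suc zero) = refl
inv1423ˡ (suc (suc zero)) = refl
inv1423ˡ (suc (suc (suc zero))) = refl

inv1423ʳ : ∀ x → g1423 (f1423 x) ≡ x
inv1423ʳ zero = refl
inv1423ʳ (suc zero) = refl
inv1423ʳ (suc (suc zero)) = refl
inv1423ʳ (suc (suc (suc zero))) = refl

inv1432 : ∀ x → f1432 (f1432 x) ≡ x
inv1432 zero = refl
inv1432 (suc zero) = refl
inv1432 (suc (suc zero)) = refl
inv1432 (suc (suc (suc zero))) = refl

p1423 : Permutation′ 4
p1423 = permutation f1423 g1423 inv1423ˡ inv1423ʳ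

p1432 : Permutation′ 4
p1432 = permutation f1432 f1432 inv1432 inv1432

{-# OPTIONS --safe #-}
-- If a < b, every inversion (b, j) of w with w j < w a is also an inversion (a, j), so
-- L b exceeds L a by at most the number of j > b with w a < w j < w b.  Two such
-- positions j < k would make a b j k an occurrence of 1423 (if w j < w k) or of
-- 1432 (if w j > w k), so there is at most one of them.
module Submission where

open import Defs
open import Data.Nat using (ℕ; suc; _≤_; _+_; z≤n; s≤s; z<s; s<s)
open import Data.Nat.Properties
  using (≤-refl; ≤-trans; n≤1+n; +-suc; +-mono-≤; +-monoˡ-≤; +-monoʳ-≤)
open import Data.Fin using (Fin; zero; suc; inject₁; _<_; _<?_)
open import Data.Fin.Properties using (<-cmp; <-irrefl; <-asym; <-trans; ≤̄⇒inject₁<)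
open import Data.Fin.Permutation using (Permutation′; _⟨$⟩ʳ_)
open import Data.Vec.Functional using (Vector) renaming ([] to []ᵥ; _∷_ to _∷ᵥ_)
open import Data.List using ([]; _∷_; length; filter; allFin)
open import Data.List.Properties using (filter-accept)
open import Data.List.Relation.Unary.All using (All; _∷_)
open import Data.List.Relation.Unary.All.Properties using (all-filter)
open import Data.List.Relation.Unary.AllPairs using (_∷_)
open import Data.List.Relation.Unary.Unique.Propositional using (Unique)
open import Data.List.Relation.Unary.Unique.Propositional.Properties using (allFin⁺; filter⁺)
open import Data.Product using (_×_; _,_)
open import Data.Sum using (_⊎_; inj₁; inj₂)
open import Data.Empty using (⊥; ⊥-elim)
open import Function.Bundles using (Injection)
open import Function.Properties.Inverse using (↔⇒↣)
open import Relation.Binary using (_Preserves_⟶_; tri<; tri≈; tri>)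
open import Relation.Binary.PropositionalEquality using (_≡_; refl; sym; subst₂)
open import Relation.Nullary using (yes; no)
open import Relation.Nullary.Decidable using (_×-dec_)
open import Relation.Unary using (Pred; Decidable)

module _ {a} {A : Set a} where

  length-filter-≤-∷ : ∀ {p} {P : Pred A p} (P? : Decidable P) x xs →
    length (filter P? xs) ≤ length (filter P? (x ∷ xs))
  length-filter-≤-∷ P? x xs with P? x
  ... | yes _ = n≤1+n _
  ... | no _  = ≤-refl

  module _ {p q r} {P : Pred A p} {Q : Pred A q} {R : Pred A r}
           (P? : Decidable P) (Q? : Decidable Q) (R? : Decidable R) where

    length-filter-⊆-∪ : (∀ {x} → P x → Q x ⊎ R x) → ∀ xs →
      length (filter P? xs) ≤ length (filter Q? xs) + length (filter R? xs)
    length-filter-⊆-∪ P⊆Q∪R [] = z≤n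
    length-filter-⊆-∪ P⊆Q∪R (x ∷ xs) with ih ← length-filter-⊆-∪ P⊆Q∪R xs | P? x
    ... | no _ = ≤-trans ih (+-mono-≤ (length-filter-≤-∷ Q? x xs) (length-filter-≤-∷ R? x xs))
    ... | yes px with P⊆Q∪R px
    ...   | inj₁ qx rewrite filter-accept Q? {xs = xs} qx =
            s≤s (≤-trans ih (+-monoʳ-≤ _ (length-filter-≤-∷ R? x xs)))
    ...   | inj₂ rx rewrite filter-accept R? {xs = xs} rx
                          | +-suc (length (filter Q? (x ∷ xs))) (length (filter R? xs)) =
            s≤s (≤-trans ih (+-monoˡ-≤ _ (length-filter-≤-∷ Q? x xs)))

  unique-all-equal⇒length≤1 : ∀ {p} {P : Pred A p} {xs} → Unique xs → All P xs →
    (∀ {x y} → P x → P y → x ≡ y) → length xs ≤ 1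
  unique-all-equal⇒length≤1 {xs = []}         _               _              _  = z≤n
  unique-all-equal⇒length≤1 {xs = _ ∷ []}     _               _              _  = s≤s z≤n
  unique-all-equal⇒length≤1 {xs = _ ∷ _ ∷ _} ((x≢y ∷ _) ∷ _) (px ∷ py ∷ _) P≡ = ⊥-elim (x≢y (P≡ px py))

  length-filter-≤1 : ∀ {p} {P : Pred A p} (P? : Decidable P) {xs} → Unique xs →
    (∀ {x y} → P x → P y → x ≡ y) → length (filter P? xs) ≤ 1
  length-filter-≤1 P? {xs} xs-unique = unique-all-equal⇒length≤1 (filter⁺ P? xs-unique) (all-filter P? xs)

module _ {m n : ℕ} {f : Fin m → Fin n} (f↑ : f Preserves _<_ ⟶ _<_) where

  increasing-reflects-< : ∀ {x y} → f x < f y → x < y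
  increasing-reflects-< {x} {y} fx<fy with <-cmp x y
  ... | tri< x<y _ _ = x<y
  ... | tri≈ _ refl _ = ⊥-elim (<-irrefl refl fx<fy)
  ... | tri> _ _ y<x = ⊥-elim (<-asym fx<fy (f↑ y<x))

[-]-increasing : ∀ {n} {x : Fin n} → (x ∷ᵥ []ᵥ) Preserves _<_ ⟶ _<_
[-]-increasing {_} {_} {zero} {zero} ()

∷-increasing : ∀ {k n} {x : Fin n} {f : Vector (Fin n) (suc k)} →
  x < f zero → f Preserves _<_ ⟶ _<_ → (x ∷ᵥ f) Preserves _<_ ⟶ _<_
∷-increasing x<f₀ f↑ {zero}  {suc zero}    _         = x<f₀
∷-increasing x<f₀ f↑ {zero}  {suc (suc _)} _         = <-trans x<f₀ (f↑ z<s)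
∷-increasing x<f₀ f↑ {suc _} {suc _}       (s<s i<j) = f↑ i<j

increasing₄ : ∀ {n} {x₀ x₁ x₂ x₃ : Fin n} → x₀ < x₁ → x₁ < x₂ → x₂ < x₃ →
  (x₀ ∷ᵥ x₁ ∷ᵥ x₂ ∷ᵥ x₃ ∷ᵥ []ᵥ) Preserves _<_ ⟶ _<_
increasing₄ x₀<x₁ x₁<x₂ x₂<x₃ =
  ∷-increasing x₀<x₁ (∷-increasing x₁<x₂ (∷-increasing x₂<x₃ [-]-increasing))

-- vs lists the values of the occurrence in increasing order: w (ι a) is the (σ a)-th smallest.
contains-if-increasing : ∀ {n k} (w : Permutation′ n) (σ : Permutation′ k)
  (ι vs : Vector (Fin n) k) → ι Preserves _<_ ⟶ _<_ → vs Preserves _<_ ⟶ _<_ →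
  (∀ a → w ⟨$⟩ʳ ι a ≡ vs (σ ⟨$⟩ʳ a)) → Contains w σ
contains-if-increasing w σ ι vs ι↑ vs↑ w∘ι≗vs∘σ =
  ι , (λ _ _ → ι↑) , λ a b →
    (λ lt → increasing-reflects-< vs↑ (subst₂ _<_ (w∘ι≗vs∘σ a) (w∘ι≗vs∘σ b) lt)) ,
    (λ lt → subst₂ _<_ (sym (w∘ι≗vs∘σ a)) (sym (w∘ι≗vs∘σ b)) (vs↑ lt))

module _ {n : ℕ} (w : Permutation′ n)
         (w∌1423 : Avoids w p1423) (w∌1432 : Avoids w p1432) where

  private
    w-injective : ∀ {i j} → w ⟨$⟩ʳ i ≡ w ⟨$⟩ʳ j → i ≡ j
    w-injective = Injection.injective (↔⇒↣ w)

  Inversion : Fin n → Fin n → Set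
  Inversion i j = i < j × w ⟨$⟩ʳ j < w ⟨$⟩ʳ i

  inversion? : ∀ i → Decidable (Inversion i)
  inversion? i j = (i <? j) ×-dec ((w ⟨$⟩ʳ j) <? (w ⟨$⟩ʳ i))

  Between : Fin n → Fin n → Fin n → Set
  Between a b j = b < j × w ⟨$⟩ʳ a < w ⟨$⟩ʳ j × w ⟨$⟩ʳ j < w ⟨$⟩ʳ b

  between? : ∀ a b → Decidable (Between a b)
  between? a b j = (b <? j) ×-dec ((w ⟨$⟩ʳ a <? w ⟨$⟩ʳ j) ×-dec (w ⟨$⟩ʳ j <? w ⟨$⟩ʳ b))

  ¬two-between : ∀ {a b j k} → a < b → j < k → Between a b j → Between a b k → ⊥
  ¬two-between {j = j} {k} a<b j<k (b<j , aj , jb) (_ , ak , kb)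
    with <-cmp (w ⟨$⟩ʳ j) (w ⟨$⟩ʳ k)
  ... | tri< wj<wk _ _ = w∌1423 (contains-if-increasing w p1423 _ _
          (increasing₄ a<b b<j j<k) (increasing₄ aj wj<wk kb)
          λ { zero → refl ; (suc zero) → refl
            ; (suc (suc zero)) → refl ; (suc (suc (suc zero))) → refl })
  ... | tri≈ _ wj≡wk _ = <-irrefl (w-injective wj≡wk) j<k
  ... | tri> _ _ wk<wj = w∌1432 (contains-if-increasing w p1432 _ _
          (increasing₄ a<b b<j j<k) (increasing₄ ak wk<wj jb)
          λ { zero → refl ; (suc zero) → refl
            ; (suc (suc zero)) → refl ; (suc (suc (suc zero))) → refl })

  between-unique : ∀ {a b} → a < b → ∀ {j k} → Between a b j → Between a b k → j ≡ k
  between-unique a<b {j} {k} bj bk with <-cmp j k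
  ... | tri< j<k _ _ = ⊥-elim (¬two-between a<b j<k bj bk)
  ... | tri≈ _ j≡k _ = j≡k
  ... | tri> _ _ k<j = ⊥-elim (¬two-between a<b k<j bk bj)

  inversion-split : ∀ {a b} → a < b → ∀ {j} → Inversion b j → Inversion a j ⊎ Between a b j
  inversion-split {a} a<b {j} (b<j , wj<wb) with <-cmp (w ⟨$⟩ʳ j) (w ⟨$⟩ʳ a)
  ... | tri< wj<wa _ _ = inj₁ (<-trans a<b b<j , wj<wa)
  ... | tri≈ _ wj≡wa _ = ⊥-elim (<-irrefl (sym (w-injective wj≡wa)) (<-trans a<b b<j))
  ... | tri> _ _ wa<wj = inj₂ (b<j , wa<wj , wj<wb)

  L-increase≤1 : ∀ {a b} → a < b → L w b ≤ L w a + 1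
  L-increase≤1 {a} {b} a<b = ≤-trans
    (length-filter-⊆-∪ (inversion? b) (inversion? a) (between? a b) (inversion-split a<b) (allFin n))
    (+-monoʳ-≤ (L w a) (length-filter-≤1 (between? a b) (allFin⁺ n) (between-unique a<b)))

lemma2p1 : (n : ℕ) (w : Permutation′ (suc n)) →
    Avoids w p1423 → Avoids w p1432 →
    (i : Fin n) → L w (suc i) ≤ L w (inject₁ i) + 1
lemma2p1 n w w∌1423 w∌1432 i = L-increase≤1 w w∌1423 w∌1432 (≤̄⇒inject₁< ≤-refl)
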